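{- Let $p$ be an odd prime number and $b$ a positive integer. If $p > (b-1)^2$, then \[ h(p-b) = \frac{p}{b} + \frac{r(b-1)}{b}, \] where $r = p \bmod b$.
   Context: For an integer $x$ and a positive integer $n$, $x \bmod n$ denotes the least nonnegative integer congruent to $x$ modulo $n$. For an odd prime $p$ and $a \in \{0,1,\ldots,p-1\}$ the height is defined by $h(a) = \min\{ k + (ka \bmod p) : k = 1,2,\ldots,p-1\}$. -}

module Defs where

open import Data.Nat using (ℕ; zero; suc; _+_; _*_; _⊓_; NonZero)
open import Data.Nat.DivMod using (_%_)

-- minUpTo f n = min { f k : k = 1, 2, ..., n + 1 }
minUpTo : (ℕ → ℕ) → ℕ → ℕ
minUpTo f zero    = f 1
minUpTo f (suc n) = minUpTo f n ⊓ f (suc (suc n))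

-- height: h(a) = min { k + (k a mod p) : k = 1, ..., p - 1 }  (for p ≥ 2)
height : (p : ℕ) → .{{_ : NonZero p}} → ℕ → ℕ
height (suc zero)          a = 0  -- unused case (p = 1: empty range)
height p@(suc (suc m)) a = minUpTo (λ k → k + (k * a) % p) m

{-# OPTIONS --safe #-}
module Submission where

-- Write p = q b + r with r < b and let s = k (p - b) mod p, so that s + k b is a positive multiple j p.
-- If j = 1, comparing s + k b = r + q b with r < b forces k ≤ q and s = r + (q - k) b, hence k + s ≥ q + r.
-- If j ≥ 2, then b (k + s) ≥ s + k b ≥ 2p ≥ p + r (b - 1) = b (q + r), because r (b - 1) ≤ (b - 1)² < p.
-- The bound q + r is attained at k = q, where k (p - b) = (q - 1) p + r.

open import Defs
open import Data.Nat using (ℕ; zero; suc; _+_; _*_; _∸_; _^_; _≤_; _<_; _/_; z≤n; s≤s; s≤s⁻¹; z<s; NonZero; >-nonZero; ≢-nonZero⁻¹)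
open import Data.Nat.Properties
open import Data.Nat.DivMod using (_%_; m≡m%n+[m/n]*n; m%n<n; m<n⇒m%n≡m; [m+kn]%n≡m%n; m%n%n≡m%n; %-distribˡ-+; m*n%n≡0; n/1≡n; n%1≡0; m/n<m; m≥n⇒m/n>0)
open import Data.Nat.Divisibility using (_∣_; divides; m%n≡0⇒n∣m)
open import Data.Nat.Primality using (Prime; ¬prime[0]; ¬prime[1])
open import Data.Nat.Tactic.RingSolver using (solve)
open import Algebra.Properties.CommutativeSemigroup +-commutativeSemigroup using (x∙yz≈y∙xz; xy∙z≈xz∙y)
open import Data.List using ([]; _∷_)
open import Data.Product using (∃-syntax; _×_; _,_)
open import Data.Sum using (inj₁; inj₂)
open import Data.Empty using (⊥-elim)
open import Relation.Binary.PropositionalEquality using (_≡_; _≢_; refl; sym; trans; cong; cong₂; subst; module ≡-Reasoning)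

minUpTo-glb : ∀ f n {v} → (∀ {k} → 1 ≤ k → k ≤ suc n → v ≤ f k) → v ≤ minUpTo f n
minUpTo-glb f zero    bound = bound ≤-refl ≤-refl
minUpTo-glb f (suc n) bound =
  ⊓-glb (minUpTo-glb f n (λ 1≤k k≤1+n → bound 1≤k (m≤n⇒m≤1+n k≤1+n))) (bound (s≤s z≤n) ≤-refl)

minUpTo-≤ : ∀ f n {k} → 1 ≤ k → k ≤ suc n → minUpTo f n ≤ f k
minUpTo-≤ f zero    (s≤s z≤n) (s≤s z≤n) = ≤-refl
minUpTo-≤ f (suc n) 1≤k k≤2+n with m≤n⇒m<n∨m≡n k≤2+n
... | inj₁ k<2+n = ≤-trans (m⊓n≤m _ _) (minUpTo-≤ f n 1≤k (s≤s⁻¹ k<2+n))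
... | inj₂ refl  = m⊓n≤n _ _

minUpTo-attained : ∀ f n {v} → (∀ {k} → 1 ≤ k → k ≤ suc n → v ≤ f k) →
                   ∃[ k ] 1 ≤ k × k ≤ suc n × f k ≡ v → minUpTo f n ≡ v
minUpTo-attained f n bound (k , 1≤k , k≤1+n , fk≡v) =
  ≤-antisym (≤-trans (minUpTo-≤ f n 1≤k k≤1+n) (≤-reflexive fk≡v)) (minUpTo-glb f n bound)

m*m<n⇒m<n : ∀ {m n} → m * m < n → m < n
m*m<n⇒m<n {zero}  0<n     = 0<n
m*m<n⇒m<n {suc m} m*m<n = ≤-<-trans (m≤m*n (suc m) (suc m)) m*m<n

s+kb≡r+qb⇒q+r≤k+s : ∀ {b} q r k s → r < b → s + k * b ≡ r + q * b → q + r ≤ k + s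
s+kb≡r+qb⇒q+r≤k+s {b} q r zero s r<b eq = begin
  q + r      ≡⟨ +-comm q r ⟩
  r + q      ≤⟨ +-monoʳ-≤ r (m≤m*n q b) ⟩
  r + q * b  ≡⟨ eq ⟨
  s + 0      ≡⟨ +-identityʳ s ⟩
  s          ∎
  where
  open ≤-Reasoning
  instance _ = >-nonZero (<-≤-trans z<s r<b)
s+kb≡r+qb⇒q+r≤k+s {b} zero r (suc k) s r<b eq = ⊥-elim (<-irrefl refl (begin-strict
  r                <⟨ r<b ⟩
  b                ≤⟨ m≤m+n b (k * b) ⟩
  b + k * b        ≤⟨ m≤n+m (b + k * b) s ⟩
  s + (b + k * b)  ≡⟨ eq ⟩
  r + 0            ≡⟨ +-identityʳ r ⟩
  r                ∎))
  where open ≤-Reasoning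
s+kb≡r+qb⇒q+r≤k+s {b} (suc q) r (suc k) s r<b eq =
  s≤s (s+kb≡r+qb⇒q+r≤k+s q r k s r<b (+-cancelˡ-≡ b _ _ (begin
    b + (s + k * b)  ≡⟨ x∙yz≈y∙xz b s (k * b) ⟩
    s + (b + k * b)  ≡⟨ eq ⟩
    r + (b + q * b)  ≡⟨ x∙yz≈y∙xz r b (q * b) ⟩
    b + (r + q * b)  ∎)))
  where open ≡-Reasoning

[1+b]*[q+r]≡n+r*b : ∀ {n} b q r → r + q * suc b ≡ n → suc b * (q + r) ≡ n + r * b
[1+b]*[q+r]≡n+r*b {n} b q r r+qb≡n = begin
  suc b * (q + r)        ≡⟨ solve (b ∷ q ∷ r ∷ []) ⟩
  r + q * suc b + r * b  ≡⟨ cong (_+ r * b) r+qb≡n ⟩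
  n + r * b              ∎
  where open ≡-Reasoning

2n≤s+kb⇒q+r≤k+s : ∀ {n b} q r k s → r + q * suc b ≡ n → r * b ≤ n → 2 * n ≤ s + k * suc b → q + r ≤ k + s
2n≤s+kb⇒q+r≤k+s {n} {b} q r k s r+qb≡n rb≤n 2n≤s+kb = *-cancelˡ-≤ (suc b) (begin
  suc b * (q + r)        ≡⟨ [1+b]*[q+r]≡n+r*b b q r r+qb≡n ⟩
  n + r * b              ≤⟨ +-monoʳ-≤ n rb≤n ⟩
  n + n                  ≡⟨ solve (n ∷ []) ⟩
  2 * n                  ≤⟨ 2n≤s+kb ⟩
  s + k * suc b          ≤⟨ +-monoˡ-≤ (k * suc b) (m≤n*m s (suc b)) ⟩
  suc b * s + k * suc b  ≡⟨ solve (b ∷ k ∷ s ∷ []) ⟩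
  suc b * (k + s)        ∎)
  where open ≤-Reasoning

n∣[k*c]%n+k*b : ∀ {n b c} .{{_ : NonZero n}} k → c + b ≡ n → n ∣ (k * c) % n + k * b
n∣[k*c]%n+k*b {n} {b} {c} k c+b≡n = m%n≡0⇒n∣m _ n (begin
  ((k * c) % n + k * b) % n            ≡⟨ %-distribˡ-+ ((k * c) % n) (k * b) n ⟩
  ((k * c) % n % n + (k * b) % n) % n  ≡⟨ cong (λ x → (x + (k * b) % n) % n) (m%n%n≡m%n (k * c) n) ⟩
  ((k * c) % n + (k * b) % n) % n      ≡⟨ %-distribˡ-+ (k * c) (k * b) n ⟨
  (k * c + k * b) % n                  ≡⟨ cong (_% n) (*-distribˡ-+ k c b) ⟨
  (k * (c + b)) % n                    ≡⟨ cong (λ x → (k * x) % n) c+b≡n ⟩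
  (k * n) % n                          ≡⟨ m*n%n≡0 k n ⟩
  0                                    ∎)
  where open ≡-Reasoning

q+r≤k+[k*c]%n : ∀ {n b c q r k} .{{_ : NonZero n}} → c + suc b ≡ n → r + q * suc b ≡ n → r < suc b → r * b ≤ n →
                1 ≤ k → q + r ≤ k + (k * c) % n
q+r≤k+[k*c]%n {n} {b} {c} {q} {r} {suc k} c+b≡n r+qb≡n r<b rb≤n (s≤s z≤n)
  with n∣[k*c]%n+k*b (suc k) c+b≡n
... | divides zero          s+kb≡0  = ⊥-elim (1+n≢0 (m+n≡0⇒n≡0 ((suc k * c) % n) s+kb≡0))
... | divides 1             s+kb≡n  = s+kb≡r+qb⇒q+r≤k+s q r (suc k) _ r<b (trans s+kb≡n (trans (+-identityʳ n) (sym r+qb≡n)))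
... | divides (suc (suc j)) s+kb≡jn = 2n≤s+kb⇒q+r≤k+s q r (suc k) _ r+qb≡n rb≤n
                                        (subst (2 * n ≤_) (sym s+kb≡jn) (*-monoˡ-≤ n (s≤s (s≤s (z≤n {j})))))

[q*c]%n≡r : ∀ {n b c q r} .{{_ : NonZero n}} → c + b ≡ n → r + q * b ≡ n → r < n → 1 ≤ q → (q * c) % n ≡ r
[q*c]%n≡r {n} {b} {c} {suc q} {r} c+b≡n r+qb≡n r<n _ = begin
  (suc q * c) % n  ≡⟨ cong (_% n) qc≡r+qn ⟩
  (r + q * n) % n  ≡⟨ [m+kn]%n≡m%n r q n ⟩
  r % n            ≡⟨ m<n⇒m%n≡m r<n ⟩
  r                ∎
  where
  open ≡-Reasoning
  qc≡r+qn : suc q * c ≡ r + q * n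
  qc≡r+qn = +-cancelʳ-≡ (suc q * b) _ _ (begin
    suc q * c + suc q * b  ≡⟨ *-distribˡ-+ (suc q) c b ⟨
    suc q * (c + b)        ≡⟨ cong (suc q *_) c+b≡n ⟩
    n + q * n              ≡⟨ cong (_+ q * n) r+qb≡n ⟨
    r + suc q * b + q * n  ≡⟨ xy∙z≈xz∙y r (suc q * b) (q * n) ⟩
    r + q * n + suc q * b  ∎)

height[n∸[1+b]]-minimiser : ∀ m b → suc b ≤ 2 + m →
  ∃[ k ] 1 ≤ k × k ≤ suc m × k + (k * (2 + m ∸ suc b)) % (2 + m) ≡ (2 + m) / suc b + (2 + m) % suc b
-- For divisor 1 the quotient n is out of range, but every k attains n.
height[n∸[1+b]]-minimiser m zero _ = 1 , ≤-refl , s≤s z≤n , (begin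
  1 + (1 * suc m) % n  ≡⟨ cong (λ x → 1 + x % n) (*-identityˡ (suc m)) ⟩
  1 + suc m % n        ≡⟨ cong suc (m<n⇒m%n≡m ≤-refl) ⟩
  n                    ≡⟨ +-identityʳ n ⟨
  n + 0                ≡⟨ cong₂ _+_ (n/1≡n n) (n%1≡0 n) ⟨
  n / 1 + n % 1        ∎)
  where
  n = 2 + m
  open ≡-Reasoning
height[n∸[1+b]]-minimiser m (suc b) d≤n =
  q , 1≤q , s≤s⁻¹ (m/n<m n d (s≤s (s≤s z≤n))) ,
  cong (q +_) ([q*c]%n≡r (m∸n+n≡m d≤n) (sym (m≡m%n+[m/n]*n n d)) (<-≤-trans (m%n<n n d) d≤n) 1≤q)
  where
  n = 2 + m
  d = 2 + b
  q = n / d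
  1≤q : 1 ≤ q
  1≤q = m≥n⇒m/n>0 d≤n

height[n∸[1+b]]≡n/[1+b]+n%[1+b] : ∀ m b → b * b < 2 + m →
                                   height (2 + m) (2 + m ∸ suc b) ≡ (2 + m) / suc b + (2 + m) % suc b
height[n∸[1+b]]≡n/[1+b]+n%[1+b] m b b*b<n =
  minUpTo-attained (λ k → k + (k * (n ∸ suc b)) % n) m
    (λ 1≤k _ → q+r≤k+[k*c]%n (m∸n+n≡m b<n) (sym (m≡m%n+[m/n]*n n (suc b))) r<b rb≤n 1≤k)
    (height[n∸[1+b]]-minimiser m b b<n)
  where
  n = 2 + m
  b<n : b < n
  b<n = m*m<n⇒m<n b*b<n
  r<b : n % suc b < suc b
  r<b = m%n<n n (suc b)
  rb≤n : n % suc b * b ≤ n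
  rb≤n = ≤-trans (*-monoˡ-≤ b (s≤s⁻¹ r<b)) (<⇒≤ b*b<n)

mainTheorem6 : (p b : ℕ) → Prime p → p ≢ 2 → .{{_ : NonZero p}} → .{{_ : NonZero b}} →
                 (b ∸ 1) ^ 2 < p →
                 b * height p (p ∸ b) ≡ p + (p % b) * (b ∸ 1)
-- Primality only serves to exclude p ≤ 1: the formula holds for every p ≥ 2.
mainTheorem6 0 _ p-prime _ _ = ⊥-elim (¬prime[0] p-prime)
mainTheorem6 1 _ p-prime _ _ = ⊥-elim (¬prime[1] p-prime)
mainTheorem6 (suc (suc _)) 0 _ _ {{_}} {{b≢0}} _ = ⊥-elim (≢-nonZero⁻¹ 0 {{b≢0}} refl)
mainTheorem6 p@(suc (suc m)) (suc b) _ _ b^2<p = begin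
  suc b * height p (p ∸ suc b)  ≡⟨ cong (suc b *_) (height[n∸[1+b]]≡n/[1+b]+n%[1+b] m b b*b<p) ⟩
  suc b * (q + r)               ≡⟨ [1+b]*[q+r]≡n+r*b b q r (sym (m≡m%n+[m/n]*n p (suc b))) ⟩
  p + r * b                     ∎
  where
  open ≡-Reasoning
  q = p / suc b
  r = p % suc b
  b*b<p : b * b < p
  b*b<p = subst (_< p) (cong (b *_) (*-identityʳ b)) b^2<p
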